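{- Let $P$ be a non-empty finite set of primes and let $q$ be the minimum element of $P$. Suppose that for all $p\in P$, \[\frac{\|p\|+q-2}{\log_q p} \leq \|q\|+q-1.\] Then for all integers $n>1$, \[\|n\|_{P,\log} \leq \|q\|_{\log} + \frac{q-1}{\log_3 q}.\]
   Context: For a positive integer $m$, $\|m\|$ denotes the minimum number of occurrences of the constant $1$ in an arithmetic expression built only from the constant $1$, addition, multiplication and parentheses whose value is $m$; for $m>1$, $\|m\|_{\log}=\|m\|/\log_3 m$. Given a non-empty finite set $P$ of primes, the $P$-algorithm builds an expression for $n>0$ as follows: (1) if $n=1$, represent $n$ as $1$ and stop; (2) if $n=p\in P$, represent $n$ by a shortest expression of $p$ (with $\|p\|$ ones) and stop; (3) if $n>1$, $n\notin P$ and $n$ is divisible by some $p\in P$, represent $n$ as (shortest expression of $p$)$\cdot\frac{n}{p}$ and continue with $\frac{n}{p}$; (4) if $n>1$ and $n$ is divisible by no $p\in P$, represent $n$ as $1+(n-1)$ and continue with $n-1$. The number of ones in the resulting expression does not depend on the choices made in step (3); it is denoted $\|n\|_P$. Equivalently: $\|1\|_P=1$; $\|p\|_P=\|p\|$ for $p\in P$; $\|n\|_P=\|p\|+\|n/p\|_P$ if $n>1$, $n\notin P$, $p\in P$, $p\mid n$; $\|n\|_P = 1+\|n-1\|_P$ if $n>1$ is divisible by no element of $P$. For $n>1$, $\|n\|_{P,\log}=\|n\|_P/\log_3 n$. -}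

module Defs where

open import Data.Nat using (ℕ; zero; suc; _+_; _*_; _≤_; _<_)
open import Data.Nat.Divisibility using (_∣_)
open import Data.Product using (Σ; _×_)
open import Data.List using (List)
open import Data.List.Membership.Propositional using (_∈_; _∉_)
open import Relation.Binary.PropositionalEquality using (_≡_)
open import Relation.Nullary using (¬_)

data Expr : Set where
  one  : Expr
  _⊕_  : Expr → Expr → Expr
  _⊗_  : Expr → Expr → Expr

val : Expr → ℕ
val one       = 1
val (e ⊕ f) = val e + val f
val (e ⊗ f) = val e * val f

ones : Expr → ℕ
ones one       = 1
ones (e ⊕ f) = ones e + ones f
ones (e ⊗ f) = ones e + ones f

IsComplexity : ℕ → ℕ → Set
IsComplexity m k =
  (Σ Expr λ e → val e ≡ m × ones e ≡ k) × (∀ e → val e ≡ m → k ≤ ones e)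

-- PRun c P n k means: some run of
-- the P-algorithm on n produces an expression with k ones.  (By the paper, k
-- does not depend on the choices made, so k = ‖n‖_P.)
data PRun (c : ℕ → ℕ) (P : List ℕ) : ℕ → ℕ → Set where
  run-one  : PRun c P 1 1
  run-prim : ∀ {p} → p ∈ P → PRun c P p (c p)
  run-div  : ∀ {n p m k} → 1 < n → n ∉ P → p ∈ P → n ≡ p * m →
             PRun c P m k → PRun c P n (c p + k)
  run-suc  : ∀ {m k} → 1 < suc m → (∀ {p} → p ∈ P → ¬ (p ∣ suc m)) →
             PRun c P m k → PRun c P (suc m) (suc k)

{-# OPTIONS --safe #-}
-- Exponentiating in base q, the claim reads q ^ ‖n‖_P ≤ n ^ D with D = ‖q‖ + q − 1.
-- A run producing k ones on n keeps the stronger invariant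
--   q ^ (k + q − 1) ≤ q ^ (n mod q) · n ^ D.
-- A +1 step is paid for by the growth of n mod q.  A factor p ≠ q costs
-- ‖p‖ + q − 2 ≤ D log_q p; the one missing power of q comes from a non-zero
-- remainder or, when q ∣ p·m, from the full slack of m (then q ∣ m).  A factor q
-- costs ‖q‖ + q − 1 = D.  The invariant fails for runs of +1 steps alone from 1
-- to n < q; there k = n, and q ^ n ≤ n ^ D follows from q < 2 ^ ‖q‖ and
-- q ^ (n − 1) ≤ n ^ (q − 1) for 2 ≤ n ≤ q.
module Submission where

open import Defs
open import Data.Nat using (ℕ; _+_; _∸_; _^_; _≤_; _<_)
open import Data.Nat.Primality using (Prime)
open import Data.List using (List; [])
open import Data.List.Relation.Unary.All using (All)
open import Data.List.Membership.Propositional using (_∈_)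
open import Relation.Binary.PropositionalEquality using (_≢_)

open import Data.Nat using (zero; suc; _*_; _%_; _/_; z≤n; s≤s; NonZero; >-nonZero)
open import Data.Nat.Properties
open import Data.Nat.Divisibility
open import Data.Nat.DivMod using (m≡m%n+[m/n]*n; m%n<n; [m+kn]%n≡m%n; m<n⇒m%n≡m)
open import Data.Nat.Primality using (prime⇒irreducible; euclidsLemma; ¬prime[0]; ¬prime[1])
open import Data.Nat.Tactic.RingSolver using (solve-∀)
open import Algebra.Properties.CommutativeSemigroup *-commutativeSemigroup
  using () renaming (interchange to *-interchange)
open import Algebra.Properties.CommutativeSemigroup +-commutativeSemigroup
  using () renaming (xy∙z≈xz∙y to +-right-comm)
open import Data.List.Relation.Unary.All using (lookup)
open import Data.List.Membership.Propositional using (_∉_)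
open import Data.Product using (_,_)
open import Function using (_∘_)
open import Data.Sum using (inj₁; inj₂)
open import Relation.Nullary using (¬_; yes; no; contradiction)
open import Relation.Binary.PropositionalEquality
  using (_≡_; refl; sym; cong; subst; subst₂; module ≡-Reasoning)

[1+x]*[1+y]≡1+[x+y+x*y] : ∀ x y → suc x * suc y ≡ suc (x + y + x * y)
[1+x]*[1+y]≡1+[x+y+x*y] = solve-∀

node<2^ones : ∀ {v} e f → v ≤ val e + val f + val e * val f → v < 2 ^ (ones e + ones f)

val<2^ones : ∀ e → val e < 2 ^ ones e
val<2^ones one     = ≤-refl
val<2^ones (e ⊕ f) = node<2^ones e f (m≤m+n (val e + val f) (val e * val f))
val<2^ones (e ⊗ f) = node<2^ones e f (m≤n+m (val e * val f) (val e + val f))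

node<2^ones {v} e f v≤ = begin
  suc v                                    ≤⟨ s≤s v≤ ⟩
  suc (val e + val f + val e * val f)      ≡⟨ [1+x]*[1+y]≡1+[x+y+x*y] (val e) (val f) ⟨
  suc (val e) * suc (val f)                ≤⟨ *-mono-≤ (val<2^ones e) (val<2^ones f) ⟩
  2 ^ ones e * 2 ^ ones f                  ≡⟨ ^-distribˡ-+-* 2 (ones e) (ones f) ⟨
  2 ^ (ones e + ones f)                    ∎
  where open ≤-Reasoning

IsComplexity⇒<2^ : ∀ {m k} → IsComplexity m k → m < 2 ^ k
IsComplexity⇒<2^ ((e , refl , refl) , _) = val<2^ones e

[1+q]^m≤[1+m]*q^m : ∀ m q → m ≤ q → suc q ^ m ≤ suc m * q ^ m
[1+q]^m≤[1+m]*q^m zero    q _   = ≤-refl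
[1+q]^m≤[1+m]*q^m (suc m) q 1+m≤q = begin
  suc q * suc q ^ m         ≤⟨ *-monoʳ-≤ (suc q) ([1+q]^m≤[1+m]*q^m m q (<⇒≤ 1+m≤q)) ⟩
  suc q * (suc m * q ^ m)   ≡⟨ *-assoc (suc q) (suc m) (q ^ m) ⟨
  suc q * suc m * q ^ m     ≤⟨ *-monoˡ-≤ (q ^ m) (+-mono-≤ 1+m≤q (≤-reflexive (*-comm q (suc m)))) ⟩
  suc (suc m) * q * q ^ m   ≡⟨ *-assoc (suc (suc m)) q (q ^ m) ⟩
  suc (suc m) * (q * q ^ m) ∎
  where open ≤-Reasoning

[1+m+d]^m≤[1+m]^[m+d] : ∀ m d → (suc m + d) ^ m ≤ suc m ^ (m + d)
[1+m+d]^m≤[1+m]^[m+d] m zero    rewrite +-identityʳ m = ≤-refl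
[1+m+d]^m≤[1+m]^[m+d] m (suc d) = begin
  (suc m + suc d) ^ m       ≡⟨ cong (_^ m) (+-suc (suc m) d) ⟩
  suc (suc m + d) ^ m       ≤⟨ [1+q]^m≤[1+m]*q^m m (suc m + d) (m≤n⇒m≤1+n (m≤m+n m d)) ⟩
  suc m * (suc m + d) ^ m   ≤⟨ *-monoʳ-≤ (suc m) ([1+m+d]^m≤[1+m]^[m+d] m d) ⟩
  suc m * suc m ^ (m + d)   ≡⟨ cong (suc m ^_) (+-suc m d) ⟨
  suc m ^ (m + suc d)       ∎
  where open ≤-Reasoning

q^n≤n^[C+q∸1] : ∀ {q n} C → q ≤ 2 ^ C → 2 ≤ n → n ≤ q → q ^ n ≤ n ^ (C + (q ∸ 1))
q^n≤n^[C+q∸1] {n = suc m} C q≤2^C 2≤n n≤q with m≤n⇒∃[o]m+o≡n n≤q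
... | d , refl = begin
  (suc m + d) * (suc m + d) ^ m     ≤⟨ *-mono-≤ q≤2^C ([1+m+d]^m≤[1+m]^[m+d] m d) ⟩
  2 ^ C * suc m ^ (m + d)           ≤⟨ *-monoˡ-≤ (suc m ^ (m + d)) (^-monoˡ-≤ C 2≤n) ⟩
  suc m ^ C * suc m ^ (m + d)       ≡⟨ ^-distribˡ-+-* (suc m) C (m + d) ⟨
  suc m ^ (C + (m + d))             ∎
  where open ≤-Reasoning

^-distribʳ-* : ∀ m n o → (m * n) ^ o ≡ m ^ o * n ^ o
^-distribʳ-* m n zero    = refl
^-distribʳ-* m n (suc o) = begin
  m * n * (m * n) ^ o       ≡⟨ cong (m * n *_) (^-distribʳ-* m n o) ⟩
  m * n * (m ^ o * n ^ o)   ≡⟨ *-interchange m n (m ^ o) (n ^ o) ⟩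
  m * m ^ o * (n * n ^ o)   ∎
  where open ≡-Reasoning

∤⇒m%n>0 : ∀ m n .{{_ : NonZero n}} → ¬ n ∣ m → 0 < m % n
∤⇒m%n>0 m n n∤m = n≢0⇒n>0 (n∤m ∘ m%n≡0⇒n∣m m n)

[1+m]%n≡1+[m%n] : ∀ m n .{{_ : NonZero n}} → ¬ n ∣ suc m → suc m % n ≡ suc (m % n)
[1+m]%n≡1+[m%n] m n n∤1+m with m≤n⇒m<n∨m≡n (m%n<n m n)
... | inj₁ 1+m%n<n = begin
  suc m % n                     ≡⟨ cong (_% n) 1+m≡ ⟩
  (suc (m % n) + m / n * n) % n ≡⟨ [m+kn]%n≡m%n (suc (m % n)) (m / n) n ⟩
  suc (m % n) % n               ≡⟨ m<n⇒m%n≡m 1+m%n<n ⟩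
  suc (m % n)                   ∎
  where
  open ≡-Reasoning
  1+m≡ : suc m ≡ suc (m % n) + m / n * n
  1+m≡ = cong suc (m≡m%n+[m/n]*n m n)
... | inj₂ 1+m%n≡n = contradiction n∣1+m n∤1+m
  where
  n∣1+m : n ∣ suc m
  n∣1+m = subst (n ∣_) (sym (cong suc (m≡m%n+[m/n]*n m n)))
            (∣m∣n⇒∣m+n (∣-reflexive (sym 1+m%n≡n)) (n∣m*n (m / n)))

prime∣prime⇒≡ : ∀ {p q} → Prime p → Prime q → q ∣ p → q ≡ p
prime∣prime⇒≡ prime[p] prime[q] q∣p with prime⇒irreducible prime[p] q∣p
... | inj₁ refl = contradiction prime[q] ¬prime[1]
... | inj₂ q≡p  = q≡p

∈∧∉⇒cofactor>1 : ∀ {P : List ℕ} {p m} → p ∈ P → p * m ∉ P → 1 < p * m → 1 < m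
∈∧∉⇒cofactor>1 {p = p} {zero} _ _ 1<p*0 =
  contradiction (subst (1 <_) (*-zeroʳ p) 1<p*0) λ ()
∈∧∉⇒cofactor>1 {p = p} {suc zero} p∈P p∉P _ =
  contradiction (subst (_∈ _) (sym (*-identityʳ p)) p∈P) p∉P
∈∧∉⇒cofactor>1 {m = suc (suc _)} _ _ _ = s≤s (s≤s z≤n)

module PRunBound (c : ℕ → ℕ) {P : List ℕ} (primes : All Prime P) (t : ℕ) where

  q : ℕ
  q = suc (suc t)

  D : ℕ
  D = c q + (q ∸ 1)

  data Invariant (n k : ℕ) : Set where
    small   : n < q → k ≡ n → Invariant n k
    bounded : q ^ (k + (q ∸ 1)) ≤ q ^ (n % q) * n ^ D → Invariant n k

  q^[a+b]≤[p*m]^D : ∀ a b {p m} → q ^ a ≤ p ^ D → q ^ b ≤ m ^ D → q ^ (a + b) ≤ (p * m) ^ D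
  q^[a+b]≤[p*m]^D a b {p} {m} qa≤ qb≤ = begin
    q ^ (a + b)      ≡⟨ ^-distribˡ-+-* q a b ⟩
    q ^ a * q ^ b    ≤⟨ *-mono-≤ qa≤ qb≤ ⟩
    p ^ D * m ^ D    ≡⟨ ^-distribʳ-* p m D ⟨
    (p * m) ^ D      ∎
    where open ≤-Reasoning

  bounded-∤ : ∀ {n k} → ¬ q ∣ n → q ^ (k + (q ∸ 2)) ≤ n ^ D → Invariant n k
  bounded-∤ {n} {k} q∤n qk≤ = bounded (begin
    q ^ (k + (q ∸ 1))       ≡⟨ cong (q ^_) (+-suc k t) ⟩
    q * q ^ (k + (q ∸ 2))   ≤⟨ *-mono-≤ q≤q^[n%q] qk≤ ⟩
    q ^ (n % q) * n ^ D     ∎)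
    where
    open ≤-Reasoning
    q≤q^[n%q] : q ≤ q ^ (n % q)
    q≤q^[n%q] = subst (_≤ q ^ (n % q)) (*-identityʳ q) (^-monoʳ-≤ q (∤⇒m%n>0 n q q∤n))

  bounded-∣ : ∀ {n k} → q ∣ n → q ^ (k + (q ∸ 1)) ≤ n ^ D → Invariant n k
  bounded-∣ {n} {k} q∣n qk≤ = bounded (subst (λ r → q ^ (k + (q ∸ 1)) ≤ q ^ r * n ^ D)
    (sym (n∣m⇒m%n≡0 n q q∣n)) (subst (q ^ (k + (q ∸ 1)) ≤_) (sym (*-identityˡ (n ^ D))) qk≤))

  Invariant⇒q^k≤n^D : ∀ {n k} → q ≤ 2 ^ c q → 1 < n → Invariant n k → q ^ k ≤ n ^ D
  Invariant⇒q^k≤n^D q≤2^cq 1<n (small n<q refl) = q^n≤n^[C+q∸1] (c q) q≤2^cq 1<n (<⇒≤ n<q)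
  Invariant⇒q^k≤n^D {n} {k} _ _ (bounded qk≤) =
    *-cancelʳ-≤ (q ^ k) (n ^ D) (q ^ (q ∸ 1)) {{m^n≢0 q (q ∸ 1)}} (begin
      q ^ k * q ^ (q ∸ 1)       ≡⟨ ^-distribˡ-+-* q k (q ∸ 1) ⟨
      q ^ (k + (q ∸ 1))         ≤⟨ qk≤ ⟩
      q ^ (n % q) * n ^ D       ≤⟨ *-monoˡ-≤ (n ^ D) (^-monoʳ-≤ q (<⇒≤pred (m%n<n n q))) ⟩
      q ^ (q ∸ 1) * n ^ D       ≡⟨ *-comm (q ^ (q ∸ 1)) (n ^ D) ⟩
      n ^ D * q ^ (q ∸ 1)       ∎)
    where open ≤-Reasoning

  Invariant⇒q^[k+q∸1]≤m^D : ∀ {m k} .{{_ : NonZero m}} → q ∣ m → Invariant m k → q ^ (k + (q ∸ 1)) ≤ m ^ D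
  Invariant⇒q^[k+q∸1]≤m^D q∣m (small m<q _) = contradiction (∣⇒≤ q∣m) (<⇒≱ m<q)
  Invariant⇒q^[k+q∸1]≤m^D {m} {k} q∣m (bounded qk≤) = begin
    q ^ (k + (q ∸ 1))      ≤⟨ qk≤ ⟩
    q ^ (m % q) * m ^ D    ≡⟨ cong (λ r → q ^ r * m ^ D) (n∣m⇒m%n≡0 m q q∣m) ⟩
    1 * m ^ D              ≡⟨ *-identityˡ (m ^ D) ⟩
    m ^ D                  ∎
    where open ≤-Reasoning

  module _ (q∈P : q ∈ P) (prime-cost : ∀ {p} → p ∈ P → q ^ (c p + (q ∸ 2)) ≤ p ^ D)
           (q≤2^cq : q ≤ 2 ^ c q) where

    ∈∧≢q⇒q∤ : ∀ {p} → p ∈ P → p ≢ q → ¬ q ∣ p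
    ∈∧≢q⇒q∤ p∈P p≢q q∣p = p≢q (sym (prime∣prime⇒≡ (lookup primes p∈P) (lookup primes q∈P) q∣p))

    invariant-suc : ∀ {m k} → ¬ q ∣ suc m → Invariant m k → Invariant (suc m) (suc k)
    invariant-suc q∤1+m (small m<q refl) with m≤n⇒m<n∨m≡n m<q
    ... | inj₁ 1+m<q = small 1+m<q refl
    ... | inj₂ 1+m≡q = contradiction (∣-reflexive (sym 1+m≡q)) q∤1+m
    invariant-suc {m} {k} q∤1+m (bounded qk≤) = bounded (begin
      q * q ^ (k + (q ∸ 1))         ≤⟨ *-monoʳ-≤ q qk≤ ⟩
      q * (q ^ (m % q) * m ^ D)     ≡⟨ *-assoc q (q ^ (m % q)) (m ^ D) ⟨
      q ^ suc (m % q) * m ^ D       ≡⟨ cong (λ r → q ^ r * m ^ D) ([1+m]%n≡1+[m%n] m q q∤1+m) ⟨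
      q ^ (suc m % q) * m ^ D       ≤⟨ *-monoʳ-≤ (q ^ (suc m % q)) (^-monoˡ-≤ D (n≤1+n m)) ⟩
      q ^ (suc m % q) * suc m ^ D   ∎)
      where open ≤-Reasoning

    invariant-*-∤ : ∀ {p m k} → p ∈ P → ¬ q ∣ p * m → q ^ k ≤ m ^ D → Invariant (p * m) (c p + k)
    invariant-*-∤ {p} {m} {k} p∈P q∤pm qk≤ =
      bounded-∤ q∤pm (subst (λ e → q ^ e ≤ (p * m) ^ D) (+-right-comm (c p) (q ∸ 2) k)
        (q^[a+b]≤[p*m]^D (c p + (q ∸ 2)) k (prime-cost p∈P) qk≤))

    invariant-*-∣ : ∀ {p m k} → p ∈ P → 1 < m → q ∣ p * m → Invariant m k → Invariant (p * m) (c p + k)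
    invariant-*-∣ {p} {m} {k} p∈P 1<m q∣pm inv with p ≟ q
    ... | yes refl = bounded-∣ q∣pm (subst (λ e → q ^ e ≤ (q * m) ^ D) (+-right-comm (c q) (q ∸ 1) k)
                       (q^[a+b]≤[p*m]^D D k ≤-refl (Invariant⇒q^k≤n^D q≤2^cq 1<m inv)))
    ... | no p≢q   = bounded-∣ q∣pm (subst (λ e → q ^ e ≤ (p * m) ^ D) (sym (+-assoc (c p) k (q ∸ 1)))
                       (q^[a+b]≤[p*m]^D (c p) (k + (q ∸ 1)) q^cp≤p^D
                         (Invariant⇒q^[k+q∸1]≤m^D {{>-nonZero (<⇒≤ 1<m)}} q∣m inv)))
      where
      q^cp≤p^D : q ^ c p ≤ p ^ D
      q^cp≤p^D = ≤-trans (^-monoʳ-≤ q (m≤m+n (c p) (q ∸ 2))) (prime-cost p∈P)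
      q∣m : q ∣ m
      q∣m with euclidsLemma p m (lookup primes q∈P) q∣pm
      ... | inj₁ q∣p = contradiction q∣p (∈∧≢q⇒q∤ p∈P p≢q)
      ... | inj₂ q∣m = q∣m

    invariant-* : ∀ {p m k} → p ∈ P → 1 < m → Invariant m k → Invariant (p * m) (c p + k)
    invariant-* {p} {m} p∈P 1<m inv with q ∣? p * m
    ... | yes q∣pm = invariant-*-∣ p∈P 1<m q∣pm inv
    ... | no q∤pm  = invariant-*-∤ p∈P q∤pm (Invariant⇒q^k≤n^D q≤2^cq 1<m inv)

    invariant : ∀ {n k} → PRun c P n k → Invariant n k
    invariant run-one = small (s≤s (s≤s z≤n)) refl
    invariant (run-prim {p} p∈P) with p ≟ q
    ... | yes refl = bounded-∣ ∣-refl ≤-refl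
    ... | no p≢q   = bounded-∤ (∈∧≢q⇒q∤ p∈P p≢q) (prime-cost p∈P)
    invariant (run-div 1<pm pm∉P p∈P refl run) =
      invariant-* p∈P (∈∧∉⇒cofactor>1 p∈P pm∉P 1<pm) (invariant run)
    invariant (run-suc _ not-divisible run) = invariant-suc (not-divisible q∈P) (invariant run)

proposition6 : (c : ℕ → ℕ) → (∀ m → 1 ≤ m → IsComplexity m (c m)) →
    (P : List ℕ) → P ≢ [] → All Prime P →
    (q : ℕ) → q ∈ P → (∀ {p} → p ∈ P → q ≤ p) →
    (∀ {p} → p ∈ P → q ^ (c p + q ∸ 2) ≤ p ^ (c q + q ∸ 1)) →
    ∀ n → 1 < n → ∀ k → PRun c P n k → q ^ k ≤ n ^ (c q + q ∸ 1)
proposition6 _ _ _ _ primes zero       q∈P _ _ _ _ _ _ = contradiction (lookup primes q∈P) ¬prime[0]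
proposition6 _ _ _ _ primes (suc zero) q∈P _ _ _ _ _ _ = contradiction (lookup primes q∈P) ¬prime[1]
proposition6 c complexity P _ primes (suc (suc t)) q∈P _ hyp n 1<n k run =
  subst (λ e → q ^ k ≤ n ^ e) (sym (+-∸-assoc (c q) 1≤q))
    (Invariant⇒q^k≤n^D q≤2^cq 1<n (invariant q∈P prime-cost′ q≤2^cq run))
  where
  open PRunBound c primes t
  1≤q : 1 ≤ q
  1≤q = s≤s z≤n
  2≤q : 2 ≤ q
  2≤q = s≤s (s≤s z≤n)
  prime-cost′ : ∀ {p} → p ∈ P → q ^ (c p + (q ∸ 2)) ≤ p ^ D
  prime-cost′ {p} p∈P = subst₂ (λ a b → q ^ a ≤ p ^ b)
    (+-∸-assoc (c p) 2≤q) (+-∸-assoc (c q) 1≤q) (hyp p∈P)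
  q≤2^cq : q ≤ 2 ^ c q
  q≤2^cq = <⇒≤ (IsComplexity⇒<2^ (complexity q 1≤q))
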